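{- Let $G$ be an infinite group and $A$ a subset of $G$. If $A$ is not small, then $A$ is $\Delta$-large.
   Context: For a subset $A$ of an infinite group $G$, define $\Delta(A)=\{g\in G : |gA\cap A|=\infty\}$, where $gA=\{ga: a\in A\}$. A subset $A\subseteq G$ is called large if there is a finite subset $F\subseteq G$ with $FA=G$ (where $FA=\{fa: f\in F, a\in A\}$); $\Delta$-large if $\Delta(A)$ is large; and small if for every large subset $L$ of $G$, the set $(G\setminus A)\cap L$ is large. -}

module Defs where

open import Level using (Level; _⊔_)
open import Algebra.Bundles using (Group)
open import Data.List using (List)
open import Data.List.Relation.Unary.All using (All)
open import Data.List.Relation.Unary.Any using (Any)
open import Data.Product using (Σ; ∃; _×_)
open import Data.Unit.Polymorphic using (⊤)
open import Relation.Nullary using (¬_)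
open import Relation.Unary using (Pred)

module _ {c ℓ : Level} (G : Group c ℓ) where
  open Group G

  Infinite : {p : Level} → Pred Carrier p → Set (c ⊔ ℓ ⊔ p)
  Infinite P = (xs : List Carrier) → ∃ λ x → P x × All (λ y → ¬ (x ≈ y)) xs

  InfiniteGroup : Set (c ⊔ ℓ)
  InfiniteGroup = Infinite {p = Level.zero} (λ _ → ⊤)

  translate : {a : Level} → Carrier → Pred Carrier a → Pred Carrier (c ⊔ ℓ ⊔ a)
  translate g A x = ∃ λ y → A y × (x ≈ g ∙ y)

  _∩_ : {a b : Level} → Pred Carrier a → Pred Carrier b → Pred Carrier (a ⊔ b)
  (P ∩ Q) x = P x × Q x

  Δ : {a : Level} → Pred Carrier a → Pred Carrier (c ⊔ ℓ ⊔ a)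
  Δ A g = Infinite (translate g A ∩ A)

  Large : {a : Level} → Pred Carrier a → Set (c ⊔ ℓ ⊔ a)
  Large A = Σ (List Carrier) λ F →
    (g : Carrier) → Any (λ f → ∃ λ y → A y × (g ≈ f ∙ y)) F

  ∁ : {a : Level} → Pred Carrier a → Pred Carrier a
  ∁ A x = ¬ A x

  Small : {a : Level} → Pred Carrier a → Set (c ⊔ ℓ ⊔ Level.suc a)
  Small {a} A = (L : Pred Carrier a) → Large L → Large (∁ A ∩ L)

  ΔLarge : {a : Level} → Pred Carrier a → Set (c ⊔ ℓ ⊔ a)
  ΔLarge A = Large (Δ A)

  RespectsEq : {a : Level} → Pred Carrier a → Set (c ⊔ ℓ ⊔ a)
  RespectsEq A = ∀ {x y} → x ≈ y → A x → A y

-- Write F·P for the set { f p : f ∈ F, p ∈ P } and call P (right) thick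
-- when every finite H ⊆ G has a right translate Hg ⊆ P.
--
-- 1. (thick-product) If FL = G and (G∖A) ∩ L is not large, then F·A is
--    thick: for finite H, the set (H⁻¹F)((G∖A) ∩ L) misses some g, and
--    then each hg = f y with y ∈ L is forced to have y ∈ A.
-- 2. (Δ-cover) If F·A is thick then F·Δ(A) = G. Otherwise some x has
--    f⁻¹x ∉ Δ(A) for all f ∈ F, so all the sets (f⁻¹x)A ∩ A lie in one
--    finite list M. Choosing y outside the finite set S S⁻¹, where
--    S = F x⁻¹ F M, and g with Hg ⊆ F·A for a suitable finite H ∋ ε, y,
--    one shows (return-to-S) that g and yg both lie in S, whence
--    y ∈ S S⁻¹ (separation), a contradiction.
-- 3. Not being small produces exactly the L and F of step 1, with
--    F·L = G; step 2 then says that the same F witnesses F·Δ(A) = G.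
module Submission where

open import Defs
open import Level using (Level; _⊔_)
open import Algebra.Bundles using (Group)
open import Relation.Unary using (Pred)
open import Relation.Nullary using (¬_)
open import Axiom.ExcludedMiddle using (ExcludedMiddle)
open import Axiom.DoubleNegationElimination using (em⇒dne)
open import Data.Empty using (⊥)
open import Data.Product using (Σ; ∃; _×_; _,_)
open import Data.List using (List; []; _∷_; _++_; cartesianProductWith)
open import Data.List.Relation.Unary.Any as Any using (Any; here; there)
open import Data.List.Relation.Unary.Any.Properties using (++⁺ˡ; ++⁺ʳ)
open import Data.List.Relation.Unary.All.Properties using (¬Any⇒All¬; All¬⇒¬Any)
open import Data.List.Membership.Propositional using (_∈_; find; lose)
open import Data.List.Membership.Propositional.Properties
  using (∈-cartesianProductWith⁺; ∈-++⁺ˡ; ∈-++⁺ʳ)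
import Relation.Binary.PropositionalEquality as ≡
import Relation.Binary.Reasoning.Setoid as SetoidReasoning

module GroupFacts {c ℓ : Level} (G : Group c ℓ) where
  open Group G
  open import Algebra.Properties.Group G using (y≈x\\z; x≈z//y)
  open SetoidReasoning setoid

  _·_ : {p : Level} → List Carrier → Pred Carrier p → Pred Carrier (c ⊔ ℓ ⊔ p)
  (F · P) z = Any (λ f → ∃ λ y → P y × z ≈ f ∙ y) F

  Thick : {p : Level} → Pred Carrier p → Set (c ⊔ p)
  Thick P = (H : List Carrier) → ∃ λ g → ∀ h → h ∈ H → P (h ∙ g)

  Enumerates : {p : Level} → List Carrier → Pred Carrier p → Set (c ⊔ ℓ ⊔ p)
  Enumerates xs P = ∀ z → P z → Any (z ≈_) xs

  Finite : {p : Level} → Pred Carrier p → Set (c ⊔ ℓ ⊔ p)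
  Finite P = Σ (List Carrier) λ xs → Enumerates xs P

  finite-union : {p : Level} (Q : Carrier → Pred Carrier p) (F : List Carrier) →
    (∀ f → f ∈ F → Finite (Q f)) → Σ (List Carrier) λ M → ∀ f → f ∈ F → Enumerates M (Q f)
  finite-union Q [] _ = [] , λ _ ()
  finite-union Q (f ∷ F) fin
    with fin f (here ≡.refl) | finite-union Q F (λ f′ f′∈F → fin f′ (there f′∈F))
  ... | xs , enum-f | M , enum-F = xs ++ M , enum
    where
    enum : ∀ f′ → f′ ∈ f ∷ F → Enumerates (xs ++ M) (Q f′)
    enum f′ (here ≡.refl) z q = ++⁺ˡ (enum-f z q)
    enum f′ (there f′∈F)  z q = ++⁺ʳ xs (enum-F f′ f′∈F z q)

  shift-left : ∀ {h g f y} → h ∙ g ≈ f ∙ y → g ≈ (h \\ f) ∙ y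
  shift-left {h} {g} {f} {y} hg≈fy = begin
    g             ≈⟨ y≈x\\z h g (f ∙ y) hg≈fy ⟩
    h \\ (f ∙ y)  ≈⟨ assoc (h ⁻¹) f y ⟨
    (h \\ f) ∙ y  ∎

  meet : {a : Level} → Pred Carrier a → Carrier → Pred Carrier (c ⊔ ℓ ⊔ a)
  meet A g = _∩_ G (translate G g A) A

  probe-lands : ∀ {x h g f a₁} → h ∙ g ≈ f ∙ a₁ → (x ∙ (f \\ h)) ∙ g ≈ x ∙ a₁
  probe-lands {x} {h} {g} {f} {a₁} hg≈fa₁ = begin
    (x ∙ (f \\ h)) ∙ g  ≈⟨ assoc x (f \\ h) g ⟩
    x ∙ ((f \\ h) ∙ g)  ≈⟨ ∙-congˡ (assoc (f ⁻¹) h g) ⟩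
    x ∙ (f \\ (h ∙ g))  ≈⟨ ∙-congˡ (y≈x\\z f a₁ (h ∙ g) (sym hg≈fa₁)) ⟨
    x ∙ a₁              ∎

  returns : Carrier → List Carrier → List Carrier → List Carrier
  returns x F M = cartesianProductWith _∙_ F (cartesianProductWith (λ f′ m → x \\ (f′ ∙ m)) F M)

  in-returns : ∀ {F M x h g f f′ a₁ a′} → f ∈ F → f′ ∈ F →
    h ∙ g ≈ f ∙ a₁ → x ∙ a₁ ≈ f′ ∙ a′ → Any (a′ ≈_) M → Any (h ∙ g ≈_) (returns x F M)
  in-returns {x = x} {h} {g} {f} {f′} {a₁} {a′} f∈F f′∈F hg≈fa₁ xa₁≈f′a′ a′∈M
    with find a′∈M
  ... | m , m∈M , a′≈m =
    lose (∈-cartesianProductWith⁺ _∙_ f∈F (∈-cartesianProductWith⁺ _ f′∈F m∈M)) (begin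
      h ∙ g                 ≈⟨ hg≈fa₁ ⟩
      f ∙ a₁                ≈⟨ ∙-congˡ (y≈x\\z x a₁ (f′ ∙ a′) xa₁≈f′a′) ⟩
      f ∙ (x \\ (f′ ∙ a′))  ≈⟨ ∙-congˡ (∙-congˡ (∙-congˡ a′≈m)) ⟩
      f ∙ (x \\ (f′ ∙ m))   ∎)

  -- If hg ∈ F·A, all the probes x f⁻¹h are moved by g into F·A, and M
  -- enumerates every (f⁻¹x)A ∩ A with f ∈ F, then hg ∈ S: writing hg = f a₁
  -- and x a₁ = f′ a′, the element a′ lies in (f′⁻¹x)A ∩ A, hence in M.
  return-to-S : {a : Level} {A : Pred Carrier a} {F M : List Carrier} {x h g : Carrier} →
    (∀ f → f ∈ F → Enumerates M (meet A (f \\ x))) →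
    (F · A) (h ∙ g) → (∀ f → f ∈ F → (F · A) ((x ∙ (f \\ h)) ∙ g)) →
    Any (h ∙ g ≈_) (returns x F M)
  return-to-S {x = x} enum hg∈FA probes∈FA with find hg∈FA
  ... | f , f∈F , a₁ , Aa₁ , hg≈fa₁ with find (probes∈FA f f∈F)
  ... | f′ , f′∈F , a′ , Aa′ , probe≈f′a′ =
    in-returns f∈F f′∈F hg≈fa₁ xa₁≈f′a′
      (enum f′ f′∈F a′ ((a₁ , Aa₁ , shift-left (sym xa₁≈f′a′)) , Aa′))
    where
    xa₁≈f′a′ : x ∙ a₁ ≈ f′ ∙ a′
    xa₁≈f′a′ = trans (sym (probe-lands hg≈fa₁)) probe≈f′a′

  separation : ∀ {g y S} → Any (g ≈_) S → Any (y ∙ g ≈_) S →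
    Any (y ≈_) (cartesianProductWith _//_ S S)
  separation {g} {y} g∈S yg∈S with find g∈S | find yg∈S
  ... | s₁ , s₁∈S , g≈s₁ | s₂ , s₂∈S , yg≈s₂ =
    lose (∈-cartesianProductWith⁺ _//_ s₂∈S s₁∈S) (begin
      y        ≈⟨ x≈z//y y g s₂ yg≈s₂ ⟩
      s₂ // g  ≈⟨ ∙-congˡ (⁻¹-cong g≈s₁) ⟩
      s₂ // s₁ ∎)

  -- The finite set H ∋ ε, y of all points whose g-translates must be in F·A.
  probes : Carrier → List Carrier → Carrier → List Carrier
  probes x F y = base ++ cartesianProductWith (λ h f → x ∙ (f \\ h)) base F
    where
    base : List Carrier
    base = ε ∷ y ∷ []

  no-escape : {a : Level} {A : Pred Carrier a} {F M : List Carrier} →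
    InfiniteGroup G → Thick (F · A) →
    (x : Carrier) → (∀ f → f ∈ F → Enumerates M (meet A (f \\ x))) → ⊥
  no-escape {F = F} {M} infinite thick x enum
    with infinite (cartesianProductWith _//_ (returns x F M) (returns x F M))
  ... | y , _ , y∉SS⁻¹ with thick (probes x F y)
  ... | g , Hg⊆FA = All¬⇒¬Any y∉SS⁻¹ (separation g∈S (returns-from (there (here ≡.refl))))
    where
    returns-from : ∀ {h} → h ∈ ε ∷ y ∷ [] → Any (h ∙ g ≈_) (returns x F M)
    returns-from h∈base = return-to-S enum (Hg⊆FA _ (∈-++⁺ˡ h∈base))
      (λ f f∈F → Hg⊆FA _ (∈-++⁺ʳ (ε ∷ y ∷ [])
        (∈-cartesianProductWith⁺ (λ h f → x ∙ (f \\ h)) h∈base f∈F)))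

    g∈S : Any (g ≈_) (returns x F M)
    g∈S = Any.map (trans (sym (identityˡ g))) (returns-from (here ≡.refl))

module Classical (em : (p : Level) → ExcludedMiddle p) where

  dne : {p : Level} {X : Set p} → ¬ ¬ X → X
  dne {p} = em⇒dne (em p)

  module _ {c ℓ : Level} (G : Group c ℓ) where
    open Group G
    open import Algebra.Properties.Group G using (\\-leftDividesˡ)
    open GroupFacts G

    finite-of-not-infinite : {p : Level} {P : Pred Carrier p} → ¬ Infinite G P → Finite P
    finite-of-not-infinite ¬infinite = dne λ ¬finite → ¬infinite λ xs → dne λ ¬fresh →
      ¬finite (xs , λ z Pz → dne λ z∉xs → ¬fresh (z , Pz , ¬Any⇒All¬ xs z∉xs))

    -- Step 1: if F·L = G and (G∖A) ∩ L is not large, then F·A is thick.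
    -- A g outside (H⁻¹F)((G∖A) ∩ L) works: hg = f y with y ∈ L forces y ∈ A.
    thick-product : {a l : Level} {A : Pred Carrier a} {L : Pred Carrier l} {F : List Carrier} →
      (∀ g → (F · L) g) → ¬ Large G (_∩_ G (∁ G A) L) → Thick (F · A)
    thick-product {A = A} {L} {F} F·L=G ¬large H =
      dne λ ¬thick → ¬large (H⁻¹F , λ g → dne λ g∉ → ¬thick (g , λ h h∈H → lands h∈H g∉))
      where
      H⁻¹F : List Carrier
      H⁻¹F = cartesianProductWith _\\_ H F

      lands : ∀ {h g} → h ∈ H → ¬ (H⁻¹F · _∩_ G (∁ G A) L) g → (F · A) (h ∙ g)
      lands {h} {g} h∈H g∉ with find (F·L=G (h ∙ g))
      ... | f , f∈F , y , Ly , hg≈fy = dne λ hg∉FA →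
        g∉ (lose (∈-cartesianProductWith⁺ _\\_ h∈H f∈F)
                 (y , ((λ Ay → hg∉FA (lose f∈F (y , Ay , hg≈fy))) , Ly) , shift-left hg≈fy))

    Δ-cover : {a : Level} {A : Pred Carrier a} {F : List Carrier} →
      InfiniteGroup G → Thick (F · A) → ∀ x → (F · Δ G A) x
    Δ-cover {A = A} {F} infinite thick x = dne λ x∉FΔ →
      let finite : ∀ f → f ∈ F → Finite (meet A (f \\ x))
          finite f f∈F = finite-of-not-infinite λ f⁻¹x∈Δ →
            x∉FΔ (lose f∈F (f \\ x , f⁻¹x∈Δ , sym (\\-leftDividesˡ f x)))
          M , enum = finite-union (λ f → meet A (f \\ x)) F finite
      in no-escape infinite thick x enum

    witness-of-not-small : {a : Level} {A : Pred Carrier a} → ¬ Small G A →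
      Σ (Pred Carrier a) λ L → Large G L × ¬ Large G (_∩_ G (∁ G A) L)
    witness-of-not-small ¬small =
      dne λ none → ¬small λ L large → dne λ ¬large → none (L , large , ¬large)

theorem1 : ((p : Level) → ExcludedMiddle p) →
    {c ℓ a : Level} (G : Group c ℓ) → InfiniteGroup G →
    (A : Pred (Group.Carrier G) a) → RespectsEq G A →
    ¬ Small G A → ΔLarge G A
theorem1 em G infinite A _ ¬small =
  let _ , (F , F·L=G) , ¬large = witness-of-not-small G ¬small
  in F , Δ-cover G infinite (thick-product G F·L=G ¬large)
  where open Classical em
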